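{- Let $p$ be a prime, $q$ a power of $p$, $F$ a field of characteristic $p$ containing $\mathbb{F}_q$, and $L\in F[x]$ a $q$-polynomial of $q$-degree $n$ with no repeated roots in its splitting field $E$ over $F$. Fix an $\mathbb{F}_q$-basis $v_1,\dots,v_n$ of the space $V$ of roots of $L$ in $E$, and for each $r\ge1$ let $\epsilon_r : H_{n,r}(\mathbb{F}_q)\to E$, $\epsilon_r P = P(v_1,\dots,v_n)$. If $\epsilon_r$ is not injective, then $\epsilon_t$ is not injective for all $t\ge r$.
   Context: A $q$-polynomial is $\sum_{i=0}^n a_i x^{q^i}$ with $a_n\ne0$ ($q$-degree $n$). $H_{n,r}(\mathbb{F}_q)$ is the $\mathbb{F}_q$-space of homogeneous polynomials of degree $r$ in $x_1,\dots,x_n$ over $\mathbb{F}_q$, together with $0$. -}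

module Defs where

open import Level using (0ℓ)
open import Data.Nat as ℕ using (ℕ; zero; suc; _∸_)
open import Data.Fin using (Fin; zero; suc; fromℕ)
open import Data.List using (List; []; _∷_; length; map; concatMap; upTo; lookup)
open import Data.Vec as Vec using (Vec)
open import Data.Product using (Σ; _×_; ∃)
open import Relation.Nullary using (¬_)
open import Relation.Binary.PropositionalEquality using (_≡_)
open import Algebra.Bundles using (CommutativeRing; Semiring)
open import Algebra.Morphism.Structures using (module RingMorphisms)
import Algebra.Definitions.RawSemiring as RS

record Field : Set₁ where
  field
    cring : CommutativeRing 0ℓ 0ℓ
  open CommutativeRing cring public
  field
    0≉1     : ¬ (0# ≈ 1#)
    inverse : ∀ x → ¬ (x ≈ 0#) → Σ Carrier (λ y → x * y ≈ 1#)

module _ (K : Field) where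
  open Field K using (Carrier; _≈_; _+_; _*_; 0#; 1#; cring)
  open RS (Semiring.rawSemiring (CommutativeRing.semiring cring)) public using () renaming (_^_ to pow; _×_ to _·1_)

  sumF : ∀ {n} → (Fin n → Carrier) → Carrier
  sumF {zero}  f = 0#
  sumF {suc n} f = f zero + sumF (λ i → f (suc i))

  prodF : ∀ {n} → (Fin n → Carrier) → Carrier
  prodF {zero}  f = 1#
  prodF {suc n} f = f zero * prodF (λ i → f (suc i))

  -- characteristic p (p·1 = 0, p prime is imposed separately)
  HasChar : ℕ → Set
  HasChar p = (p ·1 1#) ≈ 0#

-- Field homomorphisms (ring homomorphisms; automatically injective)
IsFieldHom : (K F : Field) → (Field.Carrier K → Field.Carrier F) → Set
IsFieldHom K F f =
  RingMorphisms.IsRingHomomorphism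
    (CommutativeRing.rawRing (Field.cring K))
    (CommutativeRing.rawRing (Field.cring F)) f

HasSize : Field → ℕ → Set
HasSize K q = Σ (Fin q → Field.Carrier K) λ e →
  (∀ i j → Field._≈_ K (e i) (e j) → i ≡ j) ×
  (∀ x → ∃ λ i → Field._≈_ K (e i) x)

evalQPoly : (F E : Field) (ι : Field.Carrier F → Field.Carrier E)
            (q n : ℕ) (a : Fin (suc n) → Field.Carrier F) →
            Field.Carrier E → Field.Carrier E
evalQPoly F E ι q n a x =
  sumF E (λ i → ι (a i) * (pow E x (q ℕ.^ Data.Fin.toℕ i)))
  where open Field E using (_*_)
        import Data.Fin

-- Homogeneous polynomials of degree r in n variables.
-- monos n r : the list of all exponent vectors (e_1,…,e_n) with Σ e_j = r
-- (each listed once).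

monos : (n r : ℕ) → List (Vec ℕ n)
monos zero    zero    = Vec.[] ∷ []
monos zero    (suc r) = []
monos (suc n) r       = concatMap (λ k → map (k Vec.∷_) (monos n (r ∸ k))) (upTo (suc r))

-- H_{n,r}(K): a homogeneous polynomial of degree r (or 0) is its family of
-- coefficients indexed by the monomials of degree r.
H : (K : Field) (n r : ℕ) → Set
H K n r = Fin (length (monos n r)) → Field.Carrier K

EqH : (K : Field) (n r : ℕ) → H K n r → H K n r → Set
EqH K n r P Q = ∀ m → Field._≈_ K (P m) (Q m)

evalMono : (E : Field) {n : ℕ} → (Fin n → Field.Carrier E) → Vec ℕ n → Field.Carrier E
evalMono E v e = prodF E (λ j → pow E (v j) (Vec.lookup e j))

evalH : (K E : Field) (κ : Field.Carrier K → Field.Carrier E)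
        {n : ℕ} (v : Fin n → Field.Carrier E) (r : ℕ) → H K n r → Field.Carrier E
evalH K E κ {n} v r P =
  sumF E (λ m → κ (P m) * evalMono E v (lookup (monos n r) m))
  where open Field E using (_*_)

EpsInjective : (K E : Field) (κ : Field.Carrier K → Field.Carrier E)
               {n : ℕ} (v : Fin n → Field.Carrier E) (r : ℕ) → Set
EpsInjective K E κ {n} v r =
  ∀ (P Q : H K n r) → Field._≈_ E (evalH K E κ v r P) (evalH K E κ v r Q) → EqH K n r P Q

combo : (K E : Field) (κ : Field.Carrier K → Field.Carrier E)
        {n : ℕ} → (Fin n → Field.Carrier K) → (Fin n → Field.Carrier E) → Field.Carrier E
combo K E κ c v = sumF E (λ i → κ (c i) * v i)
  where open Field E using (_*_)

-- E is generated as a field over (the image of) F by the elements satisfying R: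
-- every subfield of E containing ι(F) and all R-elements is all of E.
GeneratedBy : (F E : Field) (ι : Field.Carrier F → Field.Carrier E)
              (R : Field.Carrier E → Set) → Set₁
GeneratedBy F E ι R =
  ∀ (S : Carrier → Set) →
    (∀ x y → x ≈ y → S x → S y) →
    (∀ a → S (ι a)) →
    (∀ x → R x → S x) →
    (∀ x y → S x → S y → S (x + y)) →
    (∀ x y → S x → S y → S (x * y)) →
    (∀ x → S x → S (- x)) →
    (∀ x y → S x → x * y ≈ 1# → S y) →
    ∀ x → S x
  where open Field E using (Carrier; _≈_; _+_; _*_; -_; 1#)

-- Multiplication by x₁ maps the degree-r monomials injectively into the
-- degree-(r+1) monomials and multiplies every value by v₁.  Hence a nonzero
-- kernel element P of ε_r yields the nonzero kernel element x₁P of ε_{r+1};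
-- dually, injectivity of ε_{r+1} restricts to injectivity of ε_r.
module Submission where

open import Defs
open import Data.Nat using (ℕ; suc; _≤_; _^_)
open import Data.Nat.Primality using (Prime)
open import Data.Fin using (Fin; fromℕ)
open import Data.Product using (∃)
open import Relation.Nullary using (¬_)
open import Relation.Binary.PropositionalEquality using (_≡_)

open import Data.Nat using (zero; _∸_; _≤′_; ≤′-reflexive; ≤′-step)
open import Data.Nat.Properties using (≤⇒≤′)
open import Data.Fin using (zero; suc)
open import Data.List using (List; []; _∷_; _++_; length; lookup; map; concatMap; upTo; applyUpTo)
open import Data.List.Properties using (map-∘; map-upTo; concatMap-map; concatMap-cong; map-concatMap)
open import Data.Vec using (Vec; _∷_)
open import Function using (_∘_)
open import Relation.Binary.PropositionalEquality as ≡ using (module ≡-Reasoning)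

module WeightedSums (K E : Field) (κ : Field.Carrier K → Field.Carrier E)
                    {A : Set} (W : A → Field.Carrier E) where
  private
    module K = Field K
  open Field E hiding (zero)

  evalOn : (xs : List A) → (Fin (length xs) → K.Carrier) → Carrier
  evalOn xs P = sumF E (λ i → κ (P i) * W (lookup xs i))

  InjectiveOn : List A → Set
  InjectiveOn xs = ∀ P Q → evalOn xs P ≈ evalOn xs Q → ∀ i → P i K.≈ Q i

  injectiveOn-∷⁻ : ∀ x xs → InjectiveOn (x ∷ xs) → InjectiveOn xs
  injectiveOn-∷⁻ x xs inj P Q PQ i = inj (extend P) (extend Q) (+-cong refl PQ) (suc i)
    where
      extend : (Fin (length xs) → K.Carrier) → Fin (suc (length xs)) → K.Carrier
      extend R zero    = K.0#
      extend R (suc j) = R j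

  injectiveOn-++⁻ʳ : ∀ xs ys → InjectiveOn (xs ++ ys) → InjectiveOn ys
  injectiveOn-++⁻ʳ []       ys inj = inj
  injectiveOn-++⁻ʳ (x ∷ xs) ys inj = injectiveOn-++⁻ʳ xs ys (injectiveOn-∷⁻ x (xs ++ ys) inj)

  -- The scalar c may be zero: only the implication from the image list
  -- back to the original list is claimed.
  module _ (h : A → A) (c : Carrier) (W-h : ∀ x → W (h x) ≈ c * W x) where

    along : ∀ xs → (Fin (length xs) → K.Carrier) → Fin (length (map h xs)) → K.Carrier
    along (x ∷ xs) P zero    = P zero
    along (x ∷ xs) P (suc i) = along xs (P ∘ suc) i

    along⁻ : ∀ xs P Q → (∀ j → along xs P j K.≈ along xs Q j) → ∀ i → P i K.≈ Q i
    along⁻ (x ∷ xs) P Q eq zero    = eq zero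
    along⁻ (x ∷ xs) P Q eq (suc i) = along⁻ xs (P ∘ suc) (Q ∘ suc) (eq ∘ suc) i

    evalOn-map : ∀ xs P → evalOn (map h xs) (along xs P) ≈ c * evalOn xs P
    evalOn-map []       P = sym (zeroʳ c)
    evalOn-map (x ∷ xs) P = begin
      κ (P zero) * W (h x) + evalOn (map h xs) (along xs (P ∘ suc))
        ≈⟨ +-cong (*-congˡ (W-h x)) (evalOn-map xs (P ∘ suc)) ⟩
      κ (P zero) * (c * W x) + c * evalOn xs (P ∘ suc)
        ≈⟨ +-congʳ (x∙yz≈y∙xz (κ (P zero)) c (W x)) ⟩
      c * (κ (P zero) * W x) + c * evalOn xs (P ∘ suc)
        ≈⟨ distribˡ c _ _ ⟨
      c * evalOn (x ∷ xs) P ∎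
      where open import Relation.Binary.Reasoning.Setoid setoid
            open import Algebra.Properties.CommutativeSemigroup *-commutativeSemigroup
              using (x∙yz≈y∙xz)

    injectiveOn-map⁻ : ∀ xs → InjectiveOn (map h xs) → InjectiveOn xs
    injectiveOn-map⁻ xs inj P Q PQ = along⁻ xs P Q (inj (along xs P) (along xs Q)
      (trans (evalOn-map xs P) (trans (*-congˡ PQ) (sym (evalOn-map xs Q)))))

incrHead : ∀ {n} → Vec ℕ (suc n) → Vec ℕ (suc n)
incrHead (k ∷ e) = suc k ∷ e

monos-suc : ∀ n r →
  monos (suc n) (suc r) ≡ map (0 ∷_) (monos n (suc r)) ++ map incrHead (monos (suc n) r)
monos-suc n r = ≡.cong (map (0 ∷_) (monos n (suc r)) ++_) (begin
  concatMap G (applyUpTo suc (suc r))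
    ≡⟨ ≡.cong (concatMap G) (map-upTo suc (suc r)) ⟨
  concatMap G (map suc (upTo (suc r)))
    ≡⟨ concatMap-map G suc (upTo (suc r)) ⟩
  concatMap (G ∘ suc) (upTo (suc r))
    ≡⟨ concatMap-cong (λ k → map-∘ (monos n (r ∸ k))) (upTo (suc r)) ⟩
  concatMap (map incrHead ∘ G′) (upTo (suc r))
    ≡⟨ map-concatMap incrHead G′ (upTo (suc r)) ⟨
  map incrHead (monos (suc n) r) ∎)
  where
    open ≡-Reasoning
    G G′ : ℕ → List (Vec ℕ (suc n))
    G  k = map (k ∷_) (monos n (suc r ∸ k))
    G′ k = map (k ∷_) (monos n (r ∸ k))

module Evaluation (K E : Field) (κ : Field.Carrier K → Field.Carrier E)
                  {n : ℕ} (v : Fin (suc n) → Field.Carrier E) where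
  open Field E using (_≈_; _*_; *-assoc)
  open WeightedSums K E κ (evalMono E v)

  evalMono-incrHead : ∀ e → evalMono E v (incrHead e) ≈ v zero * evalMono E v e
  evalMono-incrHead (k ∷ e) = *-assoc (v zero) _ _

  epsInjective-pred : ∀ r → EpsInjective K E κ v (suc r) → EpsInjective K E κ v r
  epsInjective-pred r inj =
    injectiveOn-map⁻ incrHead (v zero) evalMono-incrHead (monos (suc n) r)
      (injectiveOn-++⁻ʳ (map (0 ∷_) (monos n (suc r))) _
        (≡.subst InjectiveOn (monos-suc n r) inj))

  epsInjective-≤′ : ∀ {r t} → r ≤′ t → EpsInjective K E κ v t → EpsInjective K E κ v r
  epsInjective-≤′ (≤′-reflexive ≡.refl) inj = inj
  epsInjective-≤′ (≤′-step {t} r≤′t) inj  = epsInjective-≤′ r≤′t (epsInjective-pred t inj)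

mainTheorem8 : (p q k n : ℕ) → Prime p → q ≡ p ^ k →
    (F : Field) → HasChar F p →
    (K : Field) → HasSize K q →
    (ιK : Field.Carrier K → Field.Carrier F) → IsFieldHom K F ιK →
    (a : Fin (suc n) → Field.Carrier F) → ¬ Field._≈_ F (a (fromℕ n)) (Field.0# F) →
    (E : Field) (ιE : Field.Carrier F → Field.Carrier E) → IsFieldHom F E ιE →
    (v : Fin n → Field.Carrier E) →
    (∀ i → Field._≈_ E (evalQPoly F E ιE q n a (v i)) (Field.0# E)) →
    (∀ x → Field._≈_ E (evalQPoly F E ιE q n a x) (Field.0# E) →
       ∃ λ c → Field._≈_ E x (combo K E (λ z → ιE (ιK z)) c v)) →
    (∀ c → Field._≈_ E (combo K E (λ z → ιE (ιK z)) c v) (Field.0# E) →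
       ∀ i → Field._≈_ K (c i) (Field.0# K)) →
    GeneratedBy F E ιE (λ x → Field._≈_ E (evalQPoly F E ιE q n a x) (Field.0# E)) →
    (r : ℕ) → 1 ≤ r →
    ¬ EpsInjective K E (λ z → ιE (ιK z)) v r →
    ∀ t → r ≤ t → ¬ EpsInjective K E (λ z → ιE (ιK z)) v t
-- With no variables there are no monomials of positive degree, so ε_r is injective.
mainTheorem8 _ _ _ zero _ _ _ _ _ _ _ _ _ _ _ _ _ _ _ _ _ _ (suc r) _ notInj _ _ _ =
  notInj (λ _ _ _ ())
mainTheorem8 _ _ _ (suc n) _ _ _ _ K _ ιK _ _ _ E ιE _ v _ _ _ _ r _ notInj t r≤t inj =
  notInj (epsInjective-≤′ (≤⇒≤′ r≤t) inj)
  where open Evaluation K E (λ z → ιE (ιK z)) v
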